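{- Let $H$ be the triangular grid graph consisting of the six cells of the triangular tiling graph $T^\infty$ incident to a single vertex (a hexagon with center, i.e. the wheel on $7$ vertices drawn in the triangular grid). The graph obtained from $H$ by subdividing all six of its cells is word-representable.
   Context: A simple graph $G=(V,E)$ is word-representable if there is a word $w$ over $V$ such that for all distinct $x,y\in V$, $x$ and $y$ alternate in $w$ (deleting all other letters leaves $xyxy\cdots$ or $yxyx\cdots$) iff $\{x,y\}\in E$. The triangular tiling graph $T^\infty$ has vertices $(x,y)\in\mathbb{Z}^2$ placed at $(x+y/2, y\sqrt3/2)$, adjacent iff at Euclidean distance $1$; its triangular faces are cells. Subdividing a cell means adding a new vertex inside it adjacent to exactly the three vertices of the cell. -}

module Defs where

open import Data.Nat using (ℕ)
open import Data.Integer using (ℤ; +_; -[1+_]; _+_; _-_; _*_)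
open import Data.Fin using (Fin; zero; suc)
import Data.Fin.Properties as FinP
open import Data.Product using (Σ; _×_; _,_; proj₁; proj₂)
open import Data.Sum using (_⊎_)
open import Data.Empty using (⊥)
open import Data.List using (List; []; _∷_)
open import Data.List.Membership.Propositional using (_∈_)
open import Data.List.Relation.Unary.Linked using (Linked)
open import Relation.Nullary using (¬_; Dec; yes; no)
open import Relation.Binary.PropositionalEquality using (_≡_; _≢_; refl; cong)
open import Function.Bundles using (_⇔_)

module WordRep {V : Set} (_≟_ : (x y : V) → Dec (x ≡ y)) where

  restrict : V → V → List V → List V
  restrict x y [] = []
  restrict x y (z ∷ w) with z ≟ x | z ≟ y
  ... | yes _ | _     = z ∷ restrict x y w
  ... | no _  | yes _ = z ∷ restrict x y w
  ... | no _  | no _  = restrict x y w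

  -- x and y alternate in w: after deleting all other letters we obtain
  -- xyxy... or yxyx..., i.e. no two consecutive letters are equal
  Alternate : V → V → List V → Set
  Alternate x y w = Linked _≢_ (restrict x y w)

  Represents : (V → V → Set) → List V → Set
  Represents E w =
    (∀ v → v ∈ w) × (∀ x y → x ≢ y → (Alternate x y w ⇔ E x y))

  WordRepresentable : (V → V → Set) → Set
  WordRepresentable E = Σ (List V) (Represents E)

-- The triangular tiling graph T^∞: (x,y) ↦ (x + y/2, y√3/2); two points
-- are at Euclidean distance 1 iff dx² + dx·dy + dy² = 1.

Point : Set
Point = ℤ × ℤ

TAdj : Point → Point → Set
TAdj (a , b) (c , d) = dx * dx + dx * dy + dy * dy ≡ + 1
  where
    dx = c - a
    dy = d - b

hexPt : Fin 7 → Point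
hexPt zero                                   = (+ 0 , + 0)
hexPt (suc zero)                             = (+ 1 , + 0)
hexPt (suc (suc zero))                       = (+ 0 , + 1)
hexPt (suc (suc (suc zero)))                 = (-[1+ 0 ] , + 1)
hexPt (suc (suc (suc (suc zero))))           = (-[1+ 0 ] , + 0)
hexPt (suc (suc (suc (suc (suc zero)))))     = (+ 0 , -[1+ 0 ])
hexPt (suc (suc (suc (suc (suc (suc zero)))))) = (+ 1 , -[1+ 0 ])

cellVerts : Fin 6 → Point × Point × Point
cellVerts zero                               = ((+ 0 , + 0) , (+ 1 , + 0) , (+ 0 , + 1))
cellVerts (suc zero)                         = ((+ 0 , + 0) , (+ 0 , + 1) , (-[1+ 0 ] , + 1))
cellVerts (suc (suc zero))                   = ((+ 0 , + 0) , (-[1+ 0 ] , + 1) , (-[1+ 0 ] , + 0))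
cellVerts (suc (suc (suc zero)))             = ((+ 0 , + 0) , (-[1+ 0 ] , + 0) , (+ 0 , -[1+ 0 ]))
cellVerts (suc (suc (suc (suc zero))))       = ((+ 0 , + 0) , (+ 0 , -[1+ 0 ]) , (+ 1 , -[1+ 0 ]))
cellVerts (suc (suc (suc (suc (suc zero))))) = ((+ 0 , + 0) , (+ 1 , -[1+ 0 ]) , (+ 1 , + 0))

InCell : Point → Fin 6 → Set
InCell p c = (p ≡ proj₁ t) ⊎ (p ≡ proj₁ (proj₂ t)) ⊎ (p ≡ proj₂ (proj₂ t))
  where t = cellVerts c

data SV : Set where
  pt  : Fin 7 → SV
  new : Fin 6 → SV

-- Edges of H: pairs of its vertices at distance 1 in T^∞ (these are exactly
-- the edges of the six cells).  A new vertex is adjacent exactly to the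
-- three vertices of its cell.
SAdj : SV → SV → Set
SAdj (pt i)  (pt j)  = TAdj (hexPt i) (hexPt j)
SAdj (pt i)  (new c) = InCell (hexPt i) c
SAdj (new c) (pt i)  = InCell (hexPt i) c
SAdj (new c) (new d) = ⊥

_≟SV_ : (x y : SV) → Dec (x ≡ y)
pt i  ≟SV pt j with i FinP.≟ j
... | yes refl = yes refl
... | no ne    = no λ { refl → ne refl }
pt i  ≟SV new c = no λ ()
new c ≟SV pt i  = no λ ()
new c ≟SV new d with c FinP.≟ d
... | yes refl = yes refl
... | no ne    = no λ { refl → ne refl }

module Submission where

-- We exhibit an explicit word in which every one of the 13
-- letters occurs exactly three times (so the graph is even
-- 3-representable), and verify that it represents the graph.

open import Defs
import Data.Bool.Properties as BoolP
open import Data.Unit using (tt)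
open import Data.Fin using (zero; suc)
import Data.Integer as ℤ
open import Data.Product using (_×_; _,_)
import Data.Product.Properties as ProdP
open import Data.Sum using (_⊎_; inj₁; inj₂)
open import Data.List using (List; []; _∷_; map; _++_; allFin)
open import Data.List.Membership.Propositional using (_∈_)
open import Data.List.Membership.Propositional.Properties
  using (∈-map⁺; ∈-++⁺ˡ; ∈-++⁺ʳ; ∈-allFin)
import Data.List.Membership.DecPropositional as DecMembership
open import Data.List.Relation.Unary.All using (All; all?; lookup)
open import Data.List.Relation.Unary.Linked using (linked?)
open import Data.Empty using (⊥-elim)
open import Relation.Nullary using (Dec; yes; no; ¬?)
open import Relation.Nullary.Decidable using (⌊_⌋; _×-dec_; _⊎-dec_; toWitness)
open import Relation.Binary.Definitions using (DecidableEquality)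
open import Relation.Binary.PropositionalEquality using (_≡_; _≢_)
open import Function.Bundles using (_⇔_; mk⇔)

sameVerdict⇒⇔ : {A B : Set} (a : Dec A) (b : Dec B) → ⌊ a ⌋ ≡ ⌊ b ⌋ → A ⇔ B
sameVerdict⇒⇔ (yes a) (yes b) _  = mk⇔ (λ _ → b) (λ _ → a)
sameVerdict⇒⇔ (no ¬a) (no ¬b) _  = mk⇔ (λ a → ⊥-elim (¬a a)) (λ b → ⊥-elim (¬b b))
sameVerdict⇒⇔ (yes _) (no _)  ()
sameVerdict⇒⇔ (no _)  (yes _) ()

-- For a finite graph with decidable adjacency, representability of a
-- given word is a finite, decidable check.
module Certificate {V : Set} (_≟_ : DecidableEquality V)
                   {E : V → V → Set} (E? : ∀ x y → Dec (E x y)) where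

  open WordRep _≟_
  open DecMembership _≟_ using (_∈?_)

  alternate? : ∀ x y w → Dec (Alternate x y w)
  alternate? x y w = linked? (λ a b → ¬? (a ≟ b)) (restrict x y w)

  Faithful : List V → V → V → Set
  Faithful w x y = x ≡ y ⊎ ⌊ alternate? x y w ⌋ ≡ ⌊ E? x y ⌋

  Certifies : List V → List V → Set
  Certifies vs w = All (_∈ w) vs × All (λ x → All (Faithful w x) vs) vs

  certifies? : ∀ vs w → Dec (Certifies vs w)
  certifies? vs w =
    all? (_∈? w) vs ×-dec all? (λ x → all? (λ y → faithful? x y) vs) vs
    where
    faithful? : ∀ x y → Dec (Faithful w x y)
    faithful? x y = (x ≟ y) ⊎-dec (⌊ alternate? x y w ⌋ BoolP.≟ ⌊ E? x y ⌋)

  certificate-sound : (vs w : List V) → (∀ v → v ∈ vs) →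
                      Certifies vs w → Represents E w
  certificate-sound vs w complete (occurs , faithful) =
    (λ v → lookup occurs (complete v)) , represents-pair
    where
    represents-pair : ∀ x y → x ≢ y → (Alternate x y w ⇔ E x y)
    represents-pair x y x≢y with lookup (lookup faithful (complete x)) (complete y)
    ... | inj₁ x≡y  = ⊥-elim (x≢y x≡y)
    ... | inj₂ same = sameVerdict⇒⇔ (alternate? x y w) (E? x y) same

_≟Point_ : DecidableEquality Point
_≟Point_ = ProdP.≡-dec ℤ._≟_ ℤ._≟_

inCell? : ∀ p c → Dec (InCell p c)
inCell? p c = (p ≟Point _) ⊎-dec ((p ≟Point _) ⊎-dec (p ≟Point _))

sAdj? : ∀ x y → Dec (SAdj x y)
sAdj? (pt i)  (pt j)  = _ ℤ.≟ _
sAdj? (pt i)  (new c) = inCell? (hexPt i) c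
sAdj? (new c) (pt i)  = inCell? (hexPt i) c
sAdj? (new c) (new d) = no (λ ())

vertices : List SV
vertices = map pt (allFin 7) ++ map new (allFin 6)

vertices-complete : ∀ v → v ∈ vertices
vertices-complete (pt i)  = ∈-++⁺ˡ (∈-map⁺ pt (∈-allFin i))
vertices-complete (new c) = ∈-++⁺ʳ (map pt (allFin 7)) (∈-map⁺ new (∈-allFin c))

c r₁ r₂ r₃ r₄ r₅ r₆ t₁ t₂ t₃ t₄ t₅ t₆ : SV
c  = pt zero
r₁ = pt (suc zero)
r₂ = pt (suc (suc zero))
r₃ = pt (suc (suc (suc zero)))
r₄ = pt (suc (suc (suc (suc zero))))
r₅ = pt (suc (suc (suc (suc (suc zero)))))
r₆ = pt (suc (suc (suc (suc (suc (suc zero))))))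
t₁ = new zero
t₂ = new (suc zero)
t₃ = new (suc (suc zero))
t₄ = new (suc (suc (suc zero)))
t₅ = new (suc (suc (suc (suc zero))))
t₆ = new (suc (suc (suc (suc (suc zero)))))

word : List SV
word = t₆ ∷ t₅ ∷ r₆ ∷ t₁ ∷ t₄ ∷ r₃ ∷ t₃ ∷ r₄ ∷ t₂ ∷ r₂ ∷ c  ∷ r₃ ∷ r₁ ∷
       t₆ ∷ t₂ ∷ t₁ ∷ r₂ ∷ t₃ ∷ r₅ ∷ t₅ ∷ r₆ ∷ t₄ ∷ r₄ ∷ c  ∷ r₅ ∷ r₃ ∷
       t₃ ∷ t₄ ∷ r₄ ∷ t₂ ∷ t₅ ∷ r₁ ∷ t₁ ∷ r₂ ∷ t₆ ∷ r₆ ∷ c  ∷ r₁ ∷ r₅ ∷ []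

proposition1 : WordRep.WordRepresentable _≟SV_ SAdj
proposition1 =
  word , certificate-sound vertices word vertices-complete
           (toWitness {a? = certifies? vertices word} tt)
  where open Certificate _≟SV_ sAdj?
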